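{- Let $A=(\mathcal{R},\mathcal{GS},\mathcal{CS},\mathcal{E},\mathcal{S}_0)$ be a progressing planning scenario and let $m$ be the number of facts in $\mathcal{S}_0$, counting multiplicities. Then, for every $n\in\mathbb{N}$, $a\in\mathbb{Z}^+$ and $b\in\mathbb{N}$, every $(n,a,b)$-resilient trace of $A$ has length at most $(a+b+1)m$.
   Context: Timed MSR. A configuration is a finite multiset of timestamped facts $F@t$ ($F$ a ground atomic formula, $t\in\mathbb{N}$) containing exactly one $\mathit{Time}@t$ (global time $t$). The $\mathit{Tick}$ rule is $\mathit{Time}@T\to\mathit{Time}@(T+1)$. Instantaneous rules have the form $\mathit{Time}@T,\mathcal{W},F_1@T_1,\dots,F_n@T_n\mid\mathcal{C}\to\mathit{Time}@T,\mathcal{W},Q_1@(T+D_1),\dots,Q_m@(T+D_m)$, with side condition $\mathcal{W}$ and guard $\mathcal{C}$ of time constraints. They are applied via ground substitutions, with fresh constants for postcondition-only variables. A trace is a sequence of configurations linked by rule applications; its length is the number of rule applications. An instantaneous rule is progressing if (i) $n=m$; (ii) $\mathcal{C}$ contains $T\ge T_i$ for each consumed $F_i@T_i$; and (iii) some $D_j\ge 1$. Predicates are split into goal, critical and system predicates. Goal/critical specifications are finite sets of pairs (multiset of atomic formulas $F@T$ containing a goal/critical predicate, set of time constraints). A configuration is goal/critical if some instance of a pair's multiset is contained in it with the constraints satisfied. A compliant trace contains no critical configuration. System rules are $\mathit{Tick}$ or instantaneous rules not touching goal/critical facts except... more precisely, not consuming or creating goal or critical facts. Update rules are instantaneous rules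 of two kinds: system update rules, in which planning facts occur only in the side condition; and goal update rules, which consume or create a goal fact, with critical facts only in the side condition. A planning scenario $A=(\mathcal{R},\mathcal{GS},\mathcal{CS},\mathcal{E},\mathcal{S}_0)$ is progressing if all instantaneous rules in $\mathcal{R}\cup\mathcal{E}$ are progressing. $(n,a,b)$-resilience: let $t_0$ be the global time of $\mathcal{S}_0$. - A trace is $(0,a,b)$-resilient if it is a compliant trace of $\mathcal{R}$-rules from $\mathcal{S}_0$ to a goal configuration with at most $a+b$ $\mathit{Tick}$'s. - For $n>0$, it is $(n,a,b)$-resilient if it is $(0,a,b)$-resilient and the following holds. For every update rule $r\in\mathcal{E}$ applied to a configuration $\mathcal{S}_i$ of the trace with $t_i-t_0=d_i\le a$, giving $\mathcal{S}'_{i+1}$, there is an $(n-1,a-d_i,b)$-resilient trace of $\mathcal{R}$-rules from $\mathcal{S}'_{i+1}$ to a goal configuration, taken w.r.t. the scenario with initial configuration $\mathcal{S}'_{i+1}$. -}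

module Defs where

open import Data.Nat using (ℕ; zero; suc; _+_; _*_; _∸_; _≤_; _<_)
open import Data.Integer as ℤ using (ℤ; +_)
open import Data.List using (List; []; _∷_; _++_; map; length; concatMap)
open import Data.List.Membership.Propositional using (_∈_; _∉_)
open import Data.List.Relation.Unary.All using (All)
open import Data.List.Relation.Unary.Any using (Any)
open import Data.List.Relation.Binary.Permutation.Propositional using (_↭_)
open import Data.Product using (Σ; ∃; _×_; _,_; proj₁; proj₂)
open import Data.Sum using (_⊎_)
open import Relation.Binary.PropositionalEquality using (_≡_; _≢_)
open import Relation.Nullary using (¬_)

data PredKind : Set where
  goal critical system : PredKind

record Signature : Set₁ where
  field
    Pred : Set
    kind : Pred → PredKind

module Timed (sig : Signature) where
  open Signature sig

  -- Terms: variables (indexed by ℕ) or constants (the countably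
  -- infinite domain of constants is ℕ).
  data Term : Set where
    var : ℕ → Term
    con : ℕ → Term

  record Atom : Set where
    constructor _⟨_⟩
    field
      pred : Pred
      args : List Term

  record GAtom : Set where
    constructor _⟨_⟩g
    field
      pred : Pred
      args : List ℕ

  TFact : Set
  TFact = GAtom × ℕ

  -- A configuration: the unique Time@time fact together with the
  -- finite multiset (list up to permutation) of the other facts.
  record Config : Set where
    constructor ⟪_,_⟫
    field
      time  : ℕ
      facts : List TFact
  open Config public

  -- number of facts in a configuration counting multiplicities
  -- (including the Time fact)
  size : Config → ℕ
  size S = suc (length (facts S))

  constsOf : Config → List ℕ
  constsOf S = concatMap (λ f → GAtom.args (proj₁ f)) (facts S)

  -- Time constraints  T₁ > T₂ + k,  T₁ = T₂ + k,  T₁ ≥ T₂ + k  (k ∈ ℤ)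
  -- over time variables (indexed by ℕ; variable 0 is the global time T).

  data Rel : Set where
    gt eq geq : Rel

  record Constraint : Set where
    constructor tc
    field
      lhs    : ℕ
      rel    : Rel
      rhs    : ℕ
      offset : ℤ

  holdsRel : Rel → ℤ → ℤ → Set
  holdsRel gt  x y = y ℤ.< x
  holdsRel eq  x y = x ≡ y
  holdsRel geq x y = y ℤ.≤ x

  Sat : (ℕ → ℕ) → Constraint → Set
  Sat τ (tc l r k o) = holdsRel r (+ τ l) ((+ τ k) ℤ.+ o)

  -- a timed pattern F@Tᵢ : atom with a time variable
  PFact : Set
  PFact = Atom × ℕ

  -- a postcondition pattern Q@(T+D) : atom with delay D
  QFact : Set
  QFact = Atom × ℕ

  substT : (ℕ → ℕ) → Term → ℕ
  substT σ (var x) = σ x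
  substT σ (con c) = c

  substA : (ℕ → ℕ) → Atom → GAtom
  substA σ (p ⟨ ts ⟩) = p ⟨ map (substT σ) ts ⟩g

  instP : (ℕ → ℕ) → (ℕ → ℕ) → PFact → TFact
  instP σ τ (A , x) = substA σ A , τ x

  instQ : (ℕ → ℕ) → ℕ → QFact → TFact
  instQ σ t (A , d) = substA σ A , t + d

  termVars : Term → List ℕ
  termVars (var x) = x ∷ []
  termVars (con c) = []

  atomVars : List Atom → List ℕ
  atomVars = concatMap (λ A → concatMap termVars (Atom.args A))

  -- Instantaneous rules
  --   Time@T, W, F₁@T₁,…,Fₙ@Tₙ | C → Time@T, W, Q₁@(T+D₁),…,Qₘ@(T+Dₘ)

  record InstRule : Set where
    field
      W     : List PFact
      pre   : List PFact
      guard : List Constraint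
      post  : List QFact
  open InstRule public

  lhsVars : InstRule → List ℕ
  lhsVars r = atomVars (map proj₁ (W r) ++ map proj₁ (pre r))

  postVars : InstRule → List ℕ
  postVars r = atomVars (map proj₁ (post r))

  FreshVar : InstRule → ℕ → Set
  FreshVar r x = x ∈ postVars r × x ∉ lhsVars r

  record Application (r : InstRule) (S S' : Config) : Set where
    field
      σ     : ℕ → ℕ
      τ     : ℕ → ℕ
      rest  : List TFact
      now   : τ 0 ≡ time S
      split : facts S ↭ (map (instP σ τ) (W r) ++ map (instP σ τ) (pre r) ++ rest)
      guardOK : All (Sat τ) (guard r)
      fresh   : ∀ x → FreshVar r x → σ x ∉ constsOf S
      freshInj : ∀ x y → FreshVar r x → FreshVar r y → σ x ≡ σ y → x ≡ y
      result  : S' ≡ ⟪ time S , map (instP σ τ) (W r)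
                               ++ map (instQ σ (time S)) (post r) ++ rest ⟫

  SpecPair : Set
  SpecPair = List PFact × List Constraint

  Matches : Config → SpecPair → Set
  Matches S (M , C) =
    Σ (ℕ → ℕ) λ σ → Σ (ℕ → ℕ) λ τ →
      τ 0 ≡ time S
      × (∃ λ rest → facts S ↭ (map (instP σ τ) M ++ rest))
      × All (Sat τ) C

  SatisfiesSpec : List SpecPair → Config → Set
  SatisfiesSpec spec S = Any (Matches S) spec

  kindP : PFact → PredKind
  kindP f = kind (Atom.pred (proj₁ f))

  IsSystemRule : InstRule → Set
  IsSystemRule r = All (λ f → kindP f ≡ system) (pre r)
                 × All (λ f → kindP f ≡ system) (post r)

  -- planning (goal / critical) facts only in the side condition
  IsSystemUpdateRule : InstRule → Set
  IsSystemUpdateRule r = All (λ f → kindP f ≡ system) (pre r)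
                       × All (λ f → kindP f ≡ system) (post r)

  IsGoalUpdateRule : InstRule → Set
  IsGoalUpdateRule r =
    (Any (λ f → kindP f ≡ goal) (pre r) ⊎ Any (λ f → kindP f ≡ goal) (post r))
    × All (λ f → kindP f ≢ critical) (pre r)
    × All (λ f → kindP f ≢ critical) (post r)

  IsUpdateRule : InstRule → Set
  IsUpdateRule r = IsSystemUpdateRule r ⊎ IsGoalUpdateRule r

  IsProgressing : InstRule → Set
  IsProgressing r =
    length (pre r) ≡ length (post r)
    × All (λ f → tc 0 geq (proj₂ f) (+ 0) ∈ guard r) (pre r)
    × Any (λ q → 1 ≤ proj₂ q) (post r)

  WellFormedSpec : PredKind → List SpecPair → Set
  WellFormedSpec k spec = All (λ p → Any (λ f → kindP f ≡ k) (proj₁ p)) spec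

  -- Planning scenarios.  R lists the instantaneous system rules; the
  -- Tick rule is always available as a rule of R.

  record Scenario : Set where
    field
      R  : List InstRule
      GS : List SpecPair
      CS : List SpecPair
      E  : List InstRule
      S0 : Config

  IsPlanningScenario : Scenario → Set
  IsPlanningScenario A =
    All IsSystemRule (Scenario.R A) × All IsUpdateRule (Scenario.E A)
    × WellFormedSpec goal (Scenario.GS A) × WellFormedSpec critical (Scenario.CS A)

  IsProgressingScenario : Scenario → Set
  IsProgressingScenario A =
    All IsProgressing (Scenario.R A) × All IsProgressing (Scenario.E A)

  data Step (Rs : List InstRule) : Config → Config → Set where
    tick : ∀ {t fs} → Step Rs ⟪ t , fs ⟫ ⟪ suc t , fs ⟫
    inst : ∀ {S S'} (r : InstRule) → r ∈ Rs → Application r S S' → Step Rs S S'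

  data Trace (Rs : List InstRule) : Config → Config → Set where
    done : ∀ {S} → Trace Rs S S
    _▸_  : ∀ {S S' S''} → Step Rs S S' → Trace Rs S' S'' → Trace Rs S S''

  len : ∀ {Rs S S'} → Trace Rs S S' → ℕ
  len done = 0
  len (_ ▸ τ) = suc (len τ)

  isTick : ∀ {Rs S S'} → Step Rs S S' → ℕ
  isTick tick = 1
  isTick (inst _ _ _) = 0

  ticks : ∀ {Rs S S'} → Trace Rs S S' → ℕ
  ticks done = 0
  ticks (s ▸ τ) = isTick s + ticks τ

  configs : ∀ {Rs S S'} → Trace Rs S S' → List Config
  configs {S = S} done = S ∷ []
  configs {S = S} (_ ▸ τ) = S ∷ configs τ

  module Resilience (R E : List InstRule) (GS CS : List SpecPair) where

    Compliant : ∀ {S S'} → Trace R S S' → Set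
    Compliant τ = All (λ C → ¬ SatisfiesSpec CS C) (configs τ)

    Resilient0 : ℕ → ℕ → ∀ {S S'} → Trace R S S' → Set
    Resilient0 a b {S' = S'} τ = Compliant τ × SatisfiesSpec GS S' × ticks τ ≤ a + b

    Resilient : ℕ → ℕ → ℕ → ∀ {S S'} → Trace R S S' → Set
    Resilient zero a b τ = Resilient0 a b τ
    Resilient (suc n) a b {S} τ =
      Resilient0 a b τ
      × (∀ Si → Si ∈ configs τ → time Si ∸ time S ≤ a →
         ∀ r → r ∈ E → ∀ S' → Application r Si S' →
         Σ Config λ S'' → Σ (Trace R S' S'') λ τ' →
           Resilient n (a ∸ (time Si ∸ time S)) b τ')

  ResilientIn : (A : Scenario) → ℕ → ℕ → ℕ → ∀ {S'} →
                Trace (Scenario.R A) (Scenario.S0 A) S' → Set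
  ResilientIn A n a b τ = Resilience.Resilient (Scenario.R A) (Scenario.E A)
                            (Scenario.GS A) (Scenario.CS A) n a b τ

{-# OPTIONS --safe #-}
-- Call a fact due when its timestamp is not in the future. A progressing
-- rule consumes only due facts and replaces them by equally many facts, at
-- least one of which lies in the future; so it keeps the number of facts
-- and strictly decreases the number of due facts. A Tick keeps the facts and
-- can make at most all of them due. Hence fewer than size S₀ instantaneous
-- rules fire before the first Tick and between any two Ticks, so a trace
-- with at most a + b Ticks has length at most (a + b + 1) · size S₀.
module Submission where

open import Defs
open import Data.Nat using (ℕ; zero; suc; _+_; _*_; _≤_; _<_; _≤?_; z≤n; s≤s)
open import Data.Nat.Properties
import Data.Integer as ℤ
open import Data.List using (List; _++_; map; length; filter)
open import Data.List.Properties
  using (length-++; length-map; length-filter; filter-++; filter-all; filter-notAll)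
open import Data.List.Relation.Unary.All as All using (All)
import Data.List.Relation.Unary.All.Properties as All
open import Data.List.Relation.Unary.Any as Any using (Any)
import Data.List.Relation.Unary.Any.Properties as Any
open import Data.List.Relation.Binary.Permutation.Propositional using (_↭_)
open import Data.List.Relation.Binary.Permutation.Propositional.Properties
  using (↭-length; filter-↭)
open import Data.List.Membership.Propositional using (_∈_)
open import Data.Product using (_,_; proj₁; proj₂)
open import Relation.Binary.PropositionalEquality
  using (_≡_; sym; trans; cong; subst; module ≡-Reasoning)
open import Relation.Unary using (Decidable; ∁)

module _ {A : Set} where

  length-++-replace : ∀ ws {xs ys : List A} zs → length xs ≡ length ys →
                      length (ws ++ xs ++ zs) ≡ length (ws ++ ys ++ zs)
  length-++-replace ws {xs} {ys} zs eq = begin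
    length (ws ++ xs ++ zs)            ≡⟨ length-++ ws ⟩
    length ws + length (xs ++ zs)      ≡⟨ cong (length ws +_) (length-++ xs) ⟩
    length ws + (length xs + length zs) ≡⟨ cong (λ n → length ws + (n + length zs)) eq ⟩
    length ws + (length ys + length zs) ≡⟨ cong (length ws +_) (length-++ ys) ⟨
    length ws + length (ys ++ zs)      ≡⟨ length-++ ws ⟨
    length (ws ++ ys ++ zs)            ∎
    where open ≡-Reasoning

  module _ {P : A → Set} (P? : Decidable P) where

    length-filter-↭ : ∀ {xs ys} → xs ↭ ys →
                      length (filter P? xs) ≡ length (filter P? ys)
    length-filter-↭ xs↭ys = ↭-length (filter-↭ P? xs↭ys)

    length-filter-++ : ∀ xs ys → length (filter P? (xs ++ ys))
                                 ≡ length (filter P? xs) + length (filter P? ys)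
    length-filter-++ xs ys =
      trans (cong length (filter-++ P? xs ys)) (length-++ (filter P? xs))

    length-filter-++-replace-< : ∀ ws {xs ys} zs →
      All P xs → Any (∁ P) ys → length xs ≡ length ys →
      length (filter P? (ws ++ ys ++ zs)) < length (filter P? (ws ++ xs ++ zs))
    length-filter-++-replace-< ws {xs} {ys} zs all-xs some-ys eq = begin-strict
      length (filter P? (ws ++ ys ++ zs))  ≡⟨ length-filter-++ ws (ys ++ zs) ⟩
      #ws + length (filter P? (ys ++ zs))  ≡⟨ cong (#ws +_) (length-filter-++ ys zs) ⟩
      #ws + (length (filter P? ys) + #zs)  <⟨ +-monoʳ-< #ws (+-monoˡ-< #zs (filter-notAll P? ys some-ys)) ⟩
      #ws + (length ys + #zs)              ≡⟨ cong (λ n → #ws + (n + #zs)) (sym eq) ⟩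
      #ws + (length xs + #zs)              ≡⟨ cong (λ n → #ws + (n + #zs)) (sym (length-filter-all all-xs)) ⟩
      #ws + (length (filter P? xs) + #zs)  ≡⟨ cong (#ws +_) (length-filter-++ xs zs) ⟨
      #ws + length (filter P? (xs ++ zs))  ≡⟨ length-filter-++ ws (xs ++ zs) ⟨
      length (filter P? (ws ++ xs ++ zs))  ∎
      where
      open ≤-Reasoning
      #ws = length (filter P? ws)
      #zs = length (filter P? zs)
      length-filter-all : ∀ {us} → All P us → length (filter P? us) ≡ length us
      length-filter-all all-us = cong length (filter-all P? all-us)

module _ (sig : Signature) where
  open Timed sig

  due? : (t : ℕ) → Decidable (λ (f : TFact) → proj₂ f ≤ t)
  due? t f = proj₂ f ≤? t

  #due : Config → ℕ
  #due S = length (filter (due? (time S)) (facts S))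

  #due≤size : ∀ S → #due S ≤ size S
  #due≤size S = m≤n⇒m≤1+n (length-filter (due? (time S)) (facts S))

  module _ {r : InstRule} (progressing : IsProgressing r)
           {S S' : Config} (app : Application r S S') where
    open Application app

    consumed created : List TFact
    consumed = map (instP σ τ) (pre r)
    created  = map (instQ σ (time S)) (post r)

    consumed-due : All (λ f → proj₂ f ≤ time S) consumed
    consumed-due =
      All.map⁺ {f = instP σ τ} (All.map (λ {f} → guard⇒due {f}) (proj₁ (proj₂ progressing)))
      where
      guard⇒due : ∀ {f : PFact} → tc 0 geq (proj₂ f) (ℤ.+ 0) ∈ guard r → τ (proj₂ f) ≤ time S
      guard⇒due {f} c with All.lookup guardOK c
      ... | ℤ.+≤+ le = subst (τ (proj₂ f) ≤_) now (subst (_≤ τ 0) (+-identityʳ _) le)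

    created-future : Any (λ f → time S < proj₂ f) created
    created-future = Any.map⁺ (Any.map (m<m+n (time S)) (proj₂ (proj₂ progressing)))

    length-consumed≡length-created : length consumed ≡ length created
    length-consumed≡length-created =
      trans (length-map _ (pre r)) (trans (proj₁ progressing) (sym (length-map _ (post r))))

    application-size : size S' ≡ size S
    application-size rewrite result = cong suc (begin
      length (kept ++ created ++ rest)   ≡⟨ length-++-replace kept rest length-consumed≡length-created ⟨
      length (kept ++ consumed ++ rest)  ≡⟨ ↭-length split ⟨
      length (facts S)                   ∎)
      where
      open ≡-Reasoning
      kept = map (instP σ τ) (W r)

    application-#due-< : #due S' < #due S
    application-#due-< rewrite result = begin-strict
      length (filter due (kept ++ created ++ rest))   <⟨ length-filter-++-replace-< due kept rest
                                                           consumed-due (Any.map <⇒≱ created-future)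
                                                           length-consumed≡length-created ⟩
      length (filter due (kept ++ consumed ++ rest))  ≡⟨ length-filter-↭ due split ⟨
      length (filter due (facts S))                   ∎
      where
      open ≤-Reasoning
      kept = map (instP σ τ) (W r)
      due = due? (time S)

  len≤ticks*size+#due : ∀ {Rs} → All IsProgressing Rs →
                        ∀ {S S'} (tr : Trace Rs S S') → len tr ≤ ticks tr * size S + #due S
  len≤ticks*size+#due progressing done = z≤n
  len≤ticks*size+#due progressing (tick {t} {fs} ▸ tr) = begin
    suc (len tr)                                    ≤⟨ s≤s (len≤ticks*size+#due progressing tr) ⟩
    suc (ticks tr * size S + #due ⟪ suc t , fs ⟫)  ≤⟨ s≤s (+-monoʳ-≤ (ticks tr * size S) #due≤length) ⟩
    suc (ticks tr * size S + length fs)             ≡⟨ +-suc (ticks tr * size S) (length fs) ⟨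
    ticks tr * size S + size S                      ≡⟨ +-comm (ticks tr * size S) (size S) ⟩
    suc (ticks tr) * size S                         ≤⟨ m≤m+n _ _ ⟩
    suc (ticks tr) * size S + #due S                ∎
    where
    open ≤-Reasoning
    S = ⟪ t , fs ⟫
    #due≤length : #due ⟪ suc t , fs ⟫ ≤ length fs
    #due≤length = length-filter (due? (suc t)) fs
  len≤ticks*size+#due progressing (inst {S} {S'} r r∈Rs app ▸ tr) = begin
    suc (len tr)                             ≤⟨ s≤s (len≤ticks*size+#due progressing tr) ⟩
    suc (ticks tr * size S' + #due S')       ≡⟨ cong (λ s → suc (ticks tr * s + #due S')) (application-size r-progressing app) ⟩
    suc (ticks tr * size S + #due S')        ≡⟨ +-suc (ticks tr * size S) (#due S') ⟨
    ticks tr * size S + suc (#due S')        ≤⟨ +-monoʳ-≤ (ticks tr * size S) (application-#due-< r-progressing app) ⟩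
    ticks tr * size S + #due S               ∎
    where
    open ≤-Reasoning
    r-progressing = All.lookup progressing r∈Rs

  module _ {R E : List InstRule} {GS CS : List SpecPair} where
    open Resilience R E GS CS

    resilient⇒ticks≤ : ∀ n {a b S S'} {tr : Trace R S S'} → Resilient n a b tr → ticks tr ≤ a + b
    resilient⇒ticks≤ zero    (_ , _ , ticks≤)       = ticks≤
    resilient⇒ticks≤ (suc n) ((_ , _ , ticks≤) , _) = ticks≤

proposition3 : (sig : Signature) → let open Timed sig in
    (A : Scenario) → IsPlanningScenario A → IsProgressingScenario A →
    (n a b : ℕ) → 1 ≤ a →
    ∀ {S'} (τ : Trace (Scenario.R A) (Scenario.S0 A) S') →
    ResilientIn A n a b τ →
    len τ ≤ (a + b + 1) * size (Scenario.S0 A)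
proposition3 sig A _ (R-progressing , _) n a b _ τ resilient = begin
  len τ                     ≤⟨ len≤ticks*size+#due sig R-progressing τ ⟩
  ticks τ * s + #due sig S₀ ≤⟨ +-mono-≤ (*-monoˡ-≤ s (resilient⇒ticks≤ sig n resilient)) (#due≤size sig S₀) ⟩
  (a + b) * s + s           ≡⟨ cong ((a + b) * s +_) (*-identityˡ s) ⟨
  (a + b) * s + 1 * s       ≡⟨ *-distribʳ-+ s (a + b) 1 ⟨
  (a + b + 1) * s           ∎
  where
  open Timed sig
  open ≤-Reasoning
  S₀ = Scenario.S0 A
  s = size S₀
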